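{- Let $\mathcal{D}=(\mathcal{P},\mathcal{B})$ be a Steiner $3$-design with $v$ points and block size $k$, and let $G\leq\mathrm{Aut}(\mathcal{D})$. If there is an element $s\in G$ of order $3$ that fixes no point of $\mathcal{P}$, then $k$ divides $v$.
   Context: A Steiner $3$-design $\mathcal{D}=(\mathcal{P},\mathcal{B})$ consists of a finite set $\mathcal{P}$ of $v$ points and a set $\mathcal{B}$ of $k$-element subsets of $\mathcal{P}$ (blocks) such that any $3$ distinct points lie in exactly one block. An automorphism is a permutation of $\mathcal{P}$ mapping blocks to blocks; $\mathrm{Aut}(\mathcal{D})$ is the group of all automorphisms. -}

module Defs where

open import Data.Nat using (ℕ)
open import Data.Fin using (Fin)
open import Data.Fin.Subset using (Subset; _∈_; ∣_∣)
open import Data.Fin.Permutation using (Permutation′; _⟨$⟩ʳ_; _⟨$⟩ˡ_)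
open import Data.Vec using (tabulate; lookup)
open import Data.Product using (Σ; _×_)
open import Relation.Binary.PropositionalEquality using (_≡_; _≢_)
open import Relation.Nullary using (¬_)

record Steiner3Design (v k : ℕ) : Set₁ where
  field
    IsBlock    : Subset v → Set
    block-size : ∀ B → IsBlock B → ∣ B ∣ ≡ k
    steiner    : ∀ (x y z : Fin v) → x ≢ y → x ≢ z → y ≢ z →
                 Σ (Subset v) λ B → (IsBlock B × x ∈ B × y ∈ B × z ∈ B) ×
                   (∀ B′ → IsBlock B′ → x ∈ B′ → y ∈ B′ → z ∈ B′ → B′ ≡ B)

open Steiner3Design public

image : ∀ {v} → Permutation′ v → Subset v → Subset v
image σ B = tabulate λ y → lookup B (σ ⟨$⟩ˡ y)

IsAutomorphism : ∀ {v k} → Steiner3Design v k → Permutation′ v → Set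
IsAutomorphism D σ = ∀ B → IsBlock D B → IsBlock D (image σ B)

HasOrder3 : ∀ {v} → Permutation′ v → Set
HasOrder3 σ = (∀ x → σ ⟨$⟩ʳ (σ ⟨$⟩ʳ (σ ⟨$⟩ʳ x)) ≡ x)
            × ¬ (∀ x → σ ⟨$⟩ʳ x ≡ x)
            × ¬ (∀ x → σ ⟨$⟩ʳ (σ ⟨$⟩ʳ x) ≡ x)

FixedPointFree : ∀ {v} → Permutation′ v → Set
FixedPointFree σ = ∀ x → σ ⟨$⟩ʳ x ≢ x

{-# OPTIONS --safe #-}
-- The point-orbit {x, s x, s² x} of a fixed-point-free automorphism of order 3 consists of
-- three distinct points, so it lies in a unique block B x. Since s maps B x to a block through
-- the same three points, B x is s-invariant; hence every y ∈ B x has its whole orbit in B x and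
-- B y = B x. The blocks B x therefore partition the point set into classes of size k.
module Submission where

open import Defs
open import Data.Nat using (ℕ; suc; _+_; _<_)
open import Data.Nat.Properties using (+-suc)
open import Data.Nat.Induction using (<-wellFounded)
open import Data.Nat.Divisibility using (_∣_; ∣-refl; _∣0; ∣m∣n⇒∣m+n)
open import Data.Fin using (Fin)
open import Data.Fin.Permutation using (Permutation′; _⟨$⟩ʳ_; _⟨$⟩ˡ_; inverseˡ)
open import Data.Fin.Subset using (Subset; _∈_; _∉_; _⊆_; ∣_∣; _─_; ⊤; inside; outside)
open import Data.Fin.Subset.Properties
  using (nonempty?; Empty-unique; ∣⊥∣≡0; ∣⊤∣≡n; ∈⊤; drop-there; x∈p∩q⁺;
         p─q⊆p; x∈p∧x∉q⇒x∈p─q; p∩q≢∅⇒∣p─q∣<∣p∣)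
open import Data.Vec using ([]; _∷_; tabulate; lookup; here; there)
open import Data.Vec.Properties using (lookup∘tabulate; []=⇒lookup; lookup⇒[]=)
open import Data.Product using (Σ; _×_; _,_; proj₁; proj₂)
open import Function using (_∘′_)
open import Induction.WellFounded using (Acc; acc)
open import Relation.Binary.PropositionalEquality
  using (_≡_; _≢_; refl; sym; trans; cong; subst; module ≡-Reasoning)
open import Relation.Nullary using (yes; no)

x∈p─q⇒x∉q : ∀ {n} {x : Fin n} (p q : Subset n) → x ∈ p ─ q → x ∉ q
x∈p─q⇒x∉q (_ ∷ p) (_ ∷ q)      (there x∈p─q) (there x∈q) = x∈p─q⇒x∉q p q x∈p─q x∈q
x∈p─q⇒x∉q (_ ∷ p) (inside ∷ q) ()            here

q⊆p⇒∣p∣≡∣q∣+∣p─q∣ : ∀ {n} (p q : Subset n) → q ⊆ p → ∣ p ∣ ≡ ∣ q ∣ + ∣ p ─ q ∣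
q⊆p⇒∣p∣≡∣q∣+∣p─q∣ []      []           q⊆p = refl
q⊆p⇒∣p∣≡∣q∣+∣p─q∣ (_ ∷ p) (inside ∷ q) q⊆p with q⊆p here
... | here = cong suc (q⊆p⇒∣p∣≡∣q∣+∣p─q∣ p q (drop-there ∘′ q⊆p ∘′ there))
q⊆p⇒∣p∣≡∣q∣+∣p─q∣ (inside ∷ p) (outside ∷ q) q⊆p =
  trans (cong suc (q⊆p⇒∣p∣≡∣q∣+∣p─q∣ p q (drop-there ∘′ q⊆p ∘′ there)))
        (sym (+-suc ∣ q ∣ ∣ p ─ q ∣))
q⊆p⇒∣p∣≡∣q∣+∣p─q∣ (outside ∷ p) (outside ∷ q) q⊆p =
  q⊆p⇒∣p∣≡∣q∣+∣p─q∣ p q (drop-there ∘′ q⊆p ∘′ there)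

∈⇒∈image : ∀ {v} (σ : Permutation′ v) {B : Subset v} {x : Fin v} →
           x ∈ B → σ ⟨$⟩ʳ x ∈ image σ B
∈⇒∈image σ {B} {x} x∈B = lookup⇒[]= (σ ⟨$⟩ʳ x) (image σ B) (begin
  lookup (image σ B) (σ ⟨$⟩ʳ x)   ≡⟨ lookup∘tabulate (λ y → lookup B (σ ⟨$⟩ˡ y)) (σ ⟨$⟩ʳ x) ⟩
  lookup B (σ ⟨$⟩ˡ (σ ⟨$⟩ʳ x))    ≡⟨ cong (lookup B) (inverseˡ σ) ⟩
  lookup B x                      ≡⟨ []=⇒lookup x∈B ⟩
  inside                          ∎)
  where open ≡-Reasoning

module Partition {n k : ℕ} (class : Fin n → Subset n)
                 (∈-class : ∀ x → x ∈ class x)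
                 (∣class∣≡k : ∀ x → ∣ class x ∣ ≡ k)
                 (class-≡ : ∀ {x y} → y ∈ class x → class x ≡ class y) where

  Saturated : Subset n → Set
  Saturated S = ∀ {y} → y ∈ S → class y ⊆ S

  saturated-─ : ∀ {S x} → Saturated S → x ∈ S → Saturated (S ─ class x)
  saturated-─ {S} {x} sat x∈S {y} y∈S─x {z} z∈y =
    x∈p∧x∉q⇒x∈p─q (sat (p─q⊆p S (class x) y∈S─x) z∈y) λ z∈x →
      x∈p─q⇒x∉q S (class x) y∈S─x
        (subst (y ∈_) (trans (class-≡ z∈y) (sym (class-≡ z∈x))) (∈-class y))

  k∣∣saturated∣ : ∀ S → Saturated S → k ∣ ∣ S ∣
  k∣∣saturated∣ S = go S (<-wellFounded ∣ S ∣)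
    where
    go : ∀ S → Acc _<_ ∣ S ∣ → Saturated S → k ∣ ∣ S ∣
    go S (acc smaller) sat with nonempty? S
    ... | no S-empty =
      subst (k ∣_) (sym (trans (cong ∣_∣ (Empty-unique S-empty)) (∣⊥∣≡0 n))) (k ∣0)
    ... | yes (x , x∈S) = subst (k ∣_) (sym ∣S∣≡k+∣S─x∣)
            (∣m∣n⇒∣m+n ∣-refl (go (S ─ class x) (smaller ∣S─x∣<∣S∣) (saturated-─ sat x∈S)))
      where
      ∣S─x∣<∣S∣ : ∣ S ─ class x ∣ < ∣ S ∣
      ∣S─x∣<∣S∣ = p∩q≢∅⇒∣p─q∣<∣p∣ S (class x) (x , x∈p∩q⁺ (x∈S , ∈-class x))

      ∣S∣≡k+∣S─x∣ : ∣ S ∣ ≡ k + ∣ S ─ class x ∣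
      ∣S∣≡k+∣S─x∣ = trans (q⊆p⇒∣p∣≡∣q∣+∣p─q∣ S (class x) (sat x∈S))
                          (cong (_+ ∣ S ─ class x ∣) (∣class∣≡k x))

  k∣n : k ∣ n
  k∣n = subst (k ∣_) (∣⊤∣≡n n) (k∣∣saturated∣ ⊤ (λ _ _ → ∈⊤))

module OrbitBlocks {v k : ℕ} (D : Steiner3Design v k) (s : Permutation′ v)
                   (s-aut : IsAutomorphism D s)
                   (s³≡id : ∀ x → s ⟨$⟩ʳ (s ⟨$⟩ʳ (s ⟨$⟩ʳ x)) ≡ x)
                   (s-fpf : FixedPointFree s) where

  private
    σ : Fin v → Fin v
    σ x = s ⟨$⟩ʳ x

    x≢σx : ∀ x → x ≢ σ x
    x≢σx x x≡σx = s-fpf x (sym x≡σx)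

    x≢σ²x : ∀ x → x ≢ σ (σ x)
    x≢σ²x x x≡σ²x = s-fpf x (trans (cong σ x≡σ²x) (s³≡id x))

    orbit-block : ∀ x → Σ (Subset v) λ B →
                  (IsBlock D B × x ∈ B × σ x ∈ B × σ (σ x) ∈ B) ×
                  (∀ B′ → IsBlock D B′ → x ∈ B′ → σ x ∈ B′ → σ (σ x) ∈ B′ → B′ ≡ B)
    orbit-block x = steiner D x (σ x) (σ (σ x)) (x≢σx x) (x≢σ²x x) (x≢σx (σ x))

  orbitBlock : Fin v → Subset v
  orbitBlock x = proj₁ (orbit-block x)

  orbitBlock-isBlock : ∀ x → IsBlock D (orbitBlock x)
  orbitBlock-isBlock x = proj₁ (proj₁ (proj₂ (orbit-block x)))

  x∈orbitBlock : ∀ x → x ∈ orbitBlock x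
  x∈orbitBlock x = proj₁ (proj₂ (proj₁ (proj₂ (orbit-block x))))

  σx∈orbitBlock : ∀ x → σ x ∈ orbitBlock x
  σx∈orbitBlock x = proj₁ (proj₂ (proj₂ (proj₁ (proj₂ (orbit-block x)))))

  σ²x∈orbitBlock : ∀ x → σ (σ x) ∈ orbitBlock x
  σ²x∈orbitBlock x = proj₂ (proj₂ (proj₂ (proj₁ (proj₂ (orbit-block x)))))

  orbitBlock-unique : ∀ x B → IsBlock D B → x ∈ B → σ x ∈ B → σ (σ x) ∈ B → B ≡ orbitBlock x
  orbitBlock-unique x = proj₂ (proj₂ (orbit-block x))

  image-orbitBlock : ∀ x → image s (orbitBlock x) ≡ orbitBlock x
  image-orbitBlock x = orbitBlock-unique x _ (s-aut _ (orbitBlock-isBlock x))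
    (subst (_∈ image s (orbitBlock x)) (s³≡id x) (∈⇒∈image s (σ²x∈orbitBlock x)))
    (∈⇒∈image s (x∈orbitBlock x))
    (∈⇒∈image s (σx∈orbitBlock x))

  orbitBlock-closed : ∀ {x y} → y ∈ orbitBlock x → σ y ∈ orbitBlock x
  orbitBlock-closed {x} y∈B = subst (_ ∈_) (image-orbitBlock x) (∈⇒∈image s y∈B)

  orbitBlock-≡ : ∀ {x y} → y ∈ orbitBlock x → orbitBlock x ≡ orbitBlock y
  orbitBlock-≡ {x} {y} y∈B = orbitBlock-unique y (orbitBlock x) (orbitBlock-isBlock x)
    y∈B (orbitBlock-closed y∈B) (orbitBlock-closed (orbitBlock-closed y∈B))

  ∣orbitBlock∣≡k : ∀ x → ∣ orbitBlock x ∣ ≡ k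
  ∣orbitBlock∣≡k x = block-size D (orbitBlock x) (orbitBlock-isBlock x)

lemma2p5 : (v k : ℕ) (D : Steiner3Design v k) (s : Permutation′ v) →
    IsAutomorphism D s → HasOrder3 s → FixedPointFree s → k ∣ v
lemma2p5 v k D s s-aut (s³≡id , _) s-fpf =
  Partition.k∣n orbitBlock x∈orbitBlock ∣orbitBlock∣≡k orbitBlock-≡
  where open OrbitBlocks D s s-aut s³≡id s-fpf
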